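{- Let $n,k$ be positive integers with $n\ge 5$, $k<n/2$, $n = 7k/i$ for some $i \in \{1,2,3\}$, and either $n \ge 42$ or $(n,k) \in \{(28,8),(35,10),(35,15)\}$. In the game of cops and robbers on $GP(n,k)$ with three cops, if it is the robber's turn and the robber is not trapped, then the robber has a legal move after which the cops cannot, on their following turn, move so that the robber is trapped (and in particular cannot capture the robber).
   Context: The generalised Petersen graph $GP(n,k)$ has vertex set $\{a_0,\dots,a_{n-1}\}\cup\{b_0,\dots,b_{n-1}\}$ and edges $\{a_j,a_{j+1}\}$, $\{a_j,b_j\}$, $\{b_j,b_{j+k}\}$ (subscripts mod $n$). In cops and robbers, the cop player first places the cops, then the robber is placed; afterwards players alternate (cops first), each moving any or all of their pieces to adjacent vertices or staying; a cop captures the robber by occupying the robber's vertex. Trapped: the cops have trapped the robber if each of the three neighbours $v_1,v_2,v_3$ of the robber's vertex has a cop on it or on a vertex adjacent to it (regardless of whose turn it is), or if it is the cops' turn and some cop is adjacent to the robber. -}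

module Defs where

open import Data.Nat using (ℕ; _+_; _%_; NonZero)
open import Data.Fin using (Fin; toℕ)
open import Data.Product using (∃; _×_; _,_)
open import Data.Sum using (_⊎_)
open import Relation.Binary.PropositionalEquality using (_≡_)

-- Vertices of the generalised Petersen graph GP(n,k):
-- outer i = a_i, inner i = b_i  (i ∈ ℤ/nℤ, represented by Fin n).
data Vertex (n : ℕ) : Set where
  outer : Fin n → Vertex n
  inner : Fin n → Vertex n

_≡_+_mod_ : ℕ → ℕ → ℕ → (n : ℕ) → .{{NonZero n}} → Set
j ≡ i + s mod n = j ≡ (i + s) % n

Adj : (n k : ℕ) → .{{_ : NonZero n}} → Vertex n → Vertex n → Set
Adj n k (outer i) (outer j) = (toℕ j ≡ toℕ i + 1 mod n) ⊎ (toℕ i ≡ toℕ j + 1 mod n)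
Adj n k (outer i) (inner j) = i ≡ j
Adj n k (inner i) (outer j) = i ≡ j
Adj n k (inner i) (inner j) = (toℕ j ≡ toℕ i + k mod n) ⊎ (toℕ i ≡ toℕ j + k mod n)

Move : (n k : ℕ) → .{{_ : NonZero n}} → Vertex n → Vertex n → Set
Move n k u v = u ≡ v ⊎ Adj n k u v

Cops : ℕ → Set
Cops n = Fin 3 → Vertex n

-- Every neighbour of the robber's vertex r has a cop on it or adjacent to it.
-- (This is the "trapped" condition that applies regardless of whose turn it is;
--  on the robber's turn it is exactly "trapped".)
Trapped : (n k : ℕ) → .{{_ : NonZero n}} → Cops n → Vertex n → Set
Trapped n k cops r =
  ∀ v → Adj n k r v → ∃ λ c → (cops c ≡ v) ⊎ Adj n k (cops c) v

-- Since n ∣ 7k, the index p + d + s·k of a vertex a_j or b_j depends on s only modulo 7, so every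
-- vertex within distance three of the robber's vertex (of index p) is described by coordinates (d, s)
-- with |d| ≤ 4 and s < 7. For n = 7m with m ≥ 6, and by direct computation in the three exceptional
-- cases, distinct coordinates give distinct vertices; hence the ball looks like one of two fixed
-- finite graphs, according to whether the robber is on the outer or the inner rim. On each of them
-- a finite computation settles the claim. A cop is abstracted to its position in the ball, where
-- all cops outside the interior are allowed to jump freely among themselves (this only helps the
-- cops); each position gets a profile listing, for each of the robber's four options (stay or step
-- to a neighbour), which neighbours of the new vertex the cop can guard after its move; and every
-- triple of profiles either traps the robber already or leaves an option whose three neighbours
-- cannot all be guarded.
module Submission where

open import Defs
open import Data.Bool using (Bool; true; false; T; not; _∧_; _∨_; if_then_else_)
open import Data.Bool.ListAction using (all; any)
open import Data.Bool.Properties using (T-≡; T-∧; T-∨; T-not-≡)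
import Data.Bool.Properties as Bool
open import Data.Empty using (⊥-elim)
open import Data.Fin using (Fin; zero; suc; toℕ; fromℕ<; #_)
open import Data.Fin.Properties using (toℕ-fromℕ<; toℕ-injective; toℕ<n)
import Data.Fin.Properties as Fin
open import Data.List using (List; []; _∷_; map; filterᵇ; allFin; length; lookup)
open import Data.List.Membership.Propositional using (_∈_)
open import Data.List.Membership.Propositional.Properties using (∈-allFin; ∈-map⁺; ∈-filter⁺; ∈-lookup)
import Data.List.Relation.Unary.All as All
open import Data.List.Relation.Unary.All.Properties using (all⁺)
open import Data.List.Relation.Unary.Any using (here; there; satisfied)
import Data.List.Relation.Unary.Any as Any
open import Data.List.Relation.Unary.Any.Properties using (any⁺; any⁻)
open import Data.Maybe using (Maybe; just; nothing; fromMaybe)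
import Data.Maybe as Maybe
open import Data.Nat using (ℕ; zero; suc; _+_; _*_; _∸_; _%_; _/_; _≡ᵇ_; _<ᵇ_; _≤_; _<_; NonZero; s≤s; s≤s⁻¹)
open import Data.Nat.Coprimality using (Coprime; coprime?; coprime-divisor)
open import Data.Nat.Divisibility using (_∣_; divides)
open import Data.Nat.DivMod
open import Data.Nat.Properties
open import Data.Nat.Tactic.RingSolver using (solve-∀)
open import Data.Product using (∃; _×_; _,_; proj₁; proj₂; map₂)
open import Data.Sum using (_⊎_; inj₁; inj₂; [_,_]′)
open import Data.Vec using (Vec; _∷_; []; tabulate)
import Data.Vec as Vec
open import Function using (_∘_; _⇔_; mk⇔; Equivalence)
open import Relation.Binary.Definitions using (DecidableEquality)
open import Relation.Binary.PropositionalEquality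
open import Relation.Nullary using (¬_; yes; no)
open import Relation.Nullary.Decidable using (T?; isYes; toWitness; fromWitness; map′; _×-dec_)

module _ {n : ℕ} .{{_ : NonZero n}} where

  [m%n+o]%n≡[m+o]%n : ∀ m o → (m % n + o) % n ≡ (m + o) % n
  [m%n+o]%n≡[m+o]%n m o = begin
    (m % n + o) % n           ≡⟨ %-distribˡ-+ (m % n) o n ⟩
    (m % n % n + o % n) % n   ≡⟨ cong (λ z → (z + o % n) % n) (m%n%n≡m%n m n) ⟩
    (m % n + o % n) % n       ≡⟨ %-distribˡ-+ m o n ⟨
    (m + o) % n               ∎
    where open ≡-Reasoning

  [m+o%n]%n≡[m+o]%n : ∀ m o → (m + o % n) % n ≡ (m + o) % n
  [m+o%n]%n≡[m+o]%n m o = begin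
    (m + o % n) % n   ≡⟨ cong (_% n) (+-comm m (o % n)) ⟩
    (o % n + m) % n   ≡⟨ [m%n+o]%n≡[m+o]%n o m ⟩
    (o + m) % n       ≡⟨ cong (_% n) (+-comm o m) ⟩
    (m + o) % n       ∎
    where open ≡-Reasoning

  +-cancelˡ-% : ∀ m o p → (m + o) % n ≡ (m + p) % n → o % n ≡ p % n
  +-cancelˡ-% m o p eq = begin
    o % n                   ≡⟨ complement o ⟨
    (c + (m + o)) % n       ≡⟨ [m+o%n]%n≡[m+o]%n c (m + o) ⟨
    (c + (m + o) % n) % n   ≡⟨ cong (λ z → (c + z) % n) eq ⟩
    (c + (m + p) % n) % n   ≡⟨ [m+o%n]%n≡[m+o]%n c (m + p) ⟩
    (c + (m + p)) % n       ≡⟨ complement p ⟩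
    p % n                   ∎
    where
    open ≡-Reasoning
    c : ℕ
    c = n ∸ m % n
    -- c + m is a multiple of n
    complement : ∀ w → (c + (m + w)) % n ≡ w % n
    complement w = trans (cong (_% n) split) ([m+kn]%n≡m%n w (suc (m / n)) n)
      where
      rearrange : ∀ a b d w → a + (b + d + w) ≡ w + (a + b + d)
      rearrange = solve-∀
      split : c + (m + w) ≡ w + suc (m / n) * n
      split = begin
        c + (m + w)                     ≡⟨ cong (λ z → c + (z + w)) (m≡m%n+[m/n]*n m n) ⟩
        c + (m % n + m / n * n + w)     ≡⟨ rearrange c (m % n) (m / n * n) w ⟩
        w + (c + m % n + m / n * n)     ≡⟨ cong (λ z → w + (z + m / n * n)) (m∸n+n≡m (m%n≤n m n)) ⟩
        w + (n + m / n * n)             ∎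

  +-cancelʳ-%-< : ∀ {m o} d → m < n → o < n → (m + d) % n ≡ (o + d) % n → m ≡ o
  +-cancelʳ-%-< {m} {o} d m<n o<n eq = begin
    m       ≡⟨ m<n⇒m%n≡m m<n ⟨
    m % n   ≡⟨ +-cancelˡ-% d m o (trans (cong (_% n) (+-comm d m)) (trans eq (cong (_% n) (+-comm o d)))) ⟩
    o % n   ≡⟨ m<n⇒m%n≡m o<n ⟩
    o       ∎
    where open ≡-Reasoning

-- outerᶜ A s and innerᶜ A s stand for the vertices a_j and b_j with j = p − 4 + A + s·k (mod n),
-- where p is the index of the robber's vertex; see Chart below.
data Coord : Set where
  outerᶜ innerᶜ : (A s : ℕ) → Coord

succ₇ : ℕ → ℕ
succ₇ s = if s ≡ᵇ 6 then 0 else suc s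

pred₇ : ℕ → ℕ
pred₇ zero    = 6
pred₇ (suc s) = s

-- The neighbours of a_j are a_{j+1}, a_{j−1}, b_j and those of b_j are a_j, b_{j+k}, b_{j−k}.
-- The second neighbour of outerᶜ 0 s is junk; properᶜ rules it out.
neighbourᶜ : Coord → Fin 3 → Coord
neighbourᶜ (outerᶜ A s) zero             = outerᶜ (suc A) s
neighbourᶜ (outerᶜ A s) (suc zero)       = outerᶜ (A ∸ 1) s
neighbourᶜ (outerᶜ A s) (suc (suc zero)) = innerᶜ A s
neighbourᶜ (innerᶜ A s) zero             = outerᶜ A s
neighbourᶜ (innerᶜ A s) (suc zero)       = innerᶜ A (succ₇ s)
neighbourᶜ (innerᶜ A s) (suc (suc zero)) = innerᶜ A (pred₇ s)

properᶜ : Coord → Bool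
properᶜ (outerᶜ A _) = not (A ≡ᵇ 0)
properᶜ (innerᶜ _ _) = true

_≟ᶜ_ : DecidableEquality Coord
outerᶜ A s ≟ᶜ outerᶜ A′ s′ = map′ (λ { (refl , refl) → refl }) (λ { refl → refl , refl }) (A ≟ A′ ×-dec s ≟ s′)
innerᶜ A s ≟ᶜ innerᶜ A′ s′ = map′ (λ { (refl , refl) → refl }) (λ { refl → refl , refl }) (A ≟ A′ ×-dec s ≟ s′)
outerᶜ _ _ ≟ᶜ innerᶜ _ _   = no λ ()
innerᶜ _ _ ≟ᶜ outerᶜ _ _   = no λ ()

column step : Coord → ℕ
column (outerᶜ A _) = A
column (innerᶜ A _) = A
step (outerᶜ _ s) = s
step (innerᶜ _ s) = s

offset : ℕ → Coord → ℕ
offset k c = column c + step c * k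

sameSide : Coord → Coord → Bool
sameSide (outerᶜ _ _) (outerᶜ _ _) = true
sameSide (innerᶜ _ _) (innerᶜ _ _) = true
sameSide _            _            = false

module _ {n k : ℕ} .{{_ : NonZero n}} where

  Adj-sym : ∀ {u v : Vertex n} → Adj n k u v → Adj n k v u
  Adj-sym {outer i} {outer j} (inj₁ e) = inj₂ e
  Adj-sym {outer i} {outer j} (inj₂ e) = inj₁ e
  Adj-sym {outer i} {inner j} e        = sym e
  Adj-sym {inner i} {outer j} e        = sym e
  Adj-sym {inner i} {inner j} (inj₁ e) = inj₂ e
  Adj-sym {inner i} {inner j} (inj₂ e) = inj₁ e

_≟ᵛ_ : ∀ {n} → DecidableEquality (Vertex n)
outer i ≟ᵛ outer j = map′ (cong outer) (λ { refl → refl }) (i Fin.≟ j)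
inner i ≟ᵛ inner j = map′ (cong inner) (λ { refl → refl }) (i Fin.≟ j)
outer _ ≟ᵛ inner _ = no λ ()
inner _ ≟ᵛ outer _ = no λ ()

module Chart (n k : ℕ) .{{_ : NonZero n}} (4≤n : 4 ≤ n) (n∣7k : n ∣ 7 * k) (p : ℕ) where

  -- base ≡ p − 4 (mod n), so that outerᶜ 4 0 is a_p and innerᶜ 4 0 is b_p.
  base : ℕ
  base = p + (n ∸ 4)

  at : ℕ → ℕ → Fin n
  at A s = fromℕ< (m%n<n (base + (A + s * k)) n)

  chart : Coord → Vertex n
  chart (outerᶜ A s) = outer (at A s)
  chart (innerᶜ A s) = inner (at A s)

  toℕ-at : ∀ A s → toℕ (at A s) ≡ (base + (A + s * k)) % n
  toℕ-at A s = toℕ-fromℕ< _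

  at-centre : toℕ (at 4 0) ≡ p % n
  at-centre = trans (toℕ-at 4 0) (trans (cong (_% n) base+4≡p+n) ([m+n]%n≡m%n p n))
    where
    base+4≡p+n : base + (4 + 0 * k) ≡ p + n
    base+4≡p+n = trans (+-assoc p (n ∸ 4) 4) (cong (p +_) (m∸n+n≡m 4≤n))

  at-+ : ∀ A s d → (toℕ (at A s) + d) % n ≡ (base + (A + s * k) + d) % n
  at-+ A s d = trans (cong (λ z → (z + d) % n) (toℕ-at A s)) ([m%n+o]%n≡[m+o]%n _ d)

  outer-step : ∀ A s → toℕ (at (suc A) s) ≡ (toℕ (at A s) + 1) % n
  outer-step A s = trans (toℕ-at (suc A) s) (trans (cong (_% n) (rearrange base A (s * k))) (sym (at-+ A s 1)))
    where
    rearrange : ∀ a b c → a + (suc b + c) ≡ a + (b + c) + 1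
    rearrange = solve-∀

  inner-step : ∀ A s → toℕ (at A (suc s)) ≡ (toℕ (at A s) + k) % n
  inner-step A s = trans (toℕ-at A (suc s)) (trans (cong (_% n) (rearrange base A s k)) (sym (at-+ A s k)))
    where
    rearrange : ∀ a b c d → a + (b + suc c * d) ≡ a + (b + c * d) + d
    rearrange = solve-∀

  -- The inner rim closes up after seven k-steps because n ∣ 7k.
  inner-wrap : ∀ A → toℕ (at A 0) ≡ (toℕ (at A 6) + k) % n
  inner-wrap A = begin
    toℕ (at A 0)                        ≡⟨ toℕ-at A 0 ⟩
    (base + (A + 0 * k)) % n            ≡⟨ %-remove-+ʳ _ n∣7k ⟨
    (base + (A + 0 * k) + 7 * k) % n    ≡⟨ cong (_% n) (rearrange base A k) ⟩
    (base + (A + 6 * k) + k) % n        ≡⟨ at-+ A 6 k ⟨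
    (toℕ (at A 6) + k) % n              ∎
    where
    open ≡-Reasoning
    rearrange : ∀ a b c → a + (b + 0 * c) + 7 * c ≡ a + (b + 6 * c) + c
    rearrange = solve-∀

  inner-succ₇ : ∀ A s → toℕ (at A (succ₇ s)) ≡ (toℕ (at A s) + k) % n
  inner-succ₇ A s with s ≡ᵇ 6 in s≡6
  ... | true rewrite ≡ᵇ⇒≡ s 6 (subst T (sym s≡6) _) = inner-wrap A
  ... | false = inner-step A s

  inner-pred₇ : ∀ A s → toℕ (at A s) ≡ (toℕ (at A (pred₇ s)) + k) % n
  inner-pred₇ A zero    = inner-wrap A
  inner-pred₇ A (suc s) = inner-step A s

  chart-neighbour : ∀ c t → T (properᶜ c) → Adj n k (chart c) (chart (neighbourᶜ c t))
  chart-neighbour (outerᶜ A s)       zero             _ = inj₁ (outer-step A s)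
  chart-neighbour (outerᶜ (suc A) s) (suc zero)       _ = inj₂ (outer-step A s)
  chart-neighbour (outerᶜ A s)       (suc (suc zero)) _ = refl
  chart-neighbour (innerᶜ A s)       zero             _ = refl
  chart-neighbour (innerᶜ A s)       (suc zero)       _ = inj₁ (inner-succ₇ A s)
  chart-neighbour (innerᶜ A s)       (suc (suc zero)) _ = inj₂ (inner-pred₇ A s)

  chart-neighbours-complete : ∀ c → T (properᶜ c) → ∀ v → Adj n k (chart c) v →
                              ∃ λ t → chart (neighbourᶜ c t) ≡ v
  chart-neighbours-complete (outerᶜ A s) _ (outer j) (inj₁ e) =
    zero , cong outer (toℕ-injective (trans (outer-step A s) (sym e)))
  chart-neighbours-complete (outerᶜ (suc A) s) _ (outer j) (inj₂ e) =
    suc zero , cong outer (toℕ-injective (+-cancelʳ-%-< 1 (toℕ<n _) (toℕ<n j) (trans (sym (outer-step A s)) e)))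
  chart-neighbours-complete (outerᶜ A s) _ (inner j) e = suc (suc zero) , cong inner e
  chart-neighbours-complete (innerᶜ A s) _ (outer j) e = zero , cong outer e
  chart-neighbours-complete (innerᶜ A s) _ (inner j) (inj₁ e) =
    suc zero , cong inner (toℕ-injective (trans (inner-succ₇ A s) (sym e)))
  chart-neighbours-complete (innerᶜ A s) _ (inner j) (inj₂ e) =
    suc (suc zero) , cong inner (toℕ-injective (+-cancelʳ-%-< k (toℕ<n _) (toℕ<n j) (trans (sym (inner-pred₇ A s)) e)))

  at-collision : ∀ A s A′ s′ → at A s ≡ at A′ s′ → (A + s * k) % n ≡ (A′ + s′ * k) % n
  at-collision A s A′ s′ eq = +-cancelˡ-% base _ _ (trans (sym (toℕ-at A s)) (trans (cong toℕ eq) (toℕ-at A′ s′)))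

  chart-collision : ∀ c c′ → chart c ≡ chart c′ → T (sameSide c c′) × offset k c % n ≡ offset k c′ % n
  chart-collision (outerᶜ A s) (outerᶜ A′ s′) eq = _ , at-collision A s A′ s′ (outer-injective eq)
    where
    outer-injective : ∀ {i j} → outer {n} i ≡ outer j → i ≡ j
    outer-injective refl = refl
  chart-collision (innerᶜ A s) (innerᶜ A′ s′) eq = _ , at-collision A s A′ s′ (inner-injective eq)
    where
    inner-injective : ∀ {i j} → inner {n} i ≡ inner j → i ≡ j
    inner-injective refl = refl

-- Bit t of the mask of a cop records whether the cop guards the t-th neighbour of the robber's
-- (actual or prospective) vertex.
data Mask : Set where
  mask : (b₀ b₁ b₂ : Bool) → Mask

bit : Mask → Fin 3 → Bool
bit (mask b₀ _  _ ) zero             = b₀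
bit (mask _  b₁ _ ) (suc zero)       = b₁
bit (mask _  _  b₂) (suc (suc zero)) = b₂

infixr 6 _∪ᵐ_
_∪ᵐ_ : Mask → Mask → Mask
mask a₀ a₁ a₂ ∪ᵐ mask b₀ b₁ b₂ = mask (a₀ ∨ b₀) (a₁ ∨ b₁) (a₂ ∨ b₂)

full : Mask → Bool
full (mask b₀ b₁ b₂) = b₀ ∧ b₁ ∧ b₂

_≟ᵐ_ : DecidableEquality Mask
mask a₀ a₁ a₂ ≟ᵐ mask b₀ b₁ b₂ =
  map′ (λ { (refl , refl , refl) → refl }) (λ { refl → refl , refl , refl })
       (a₀ Bool.≟ b₀ ×-dec a₁ Bool.≟ b₁ ×-dec a₂ Bool.≟ b₂)

open import Data.List.Membership.DecPropositional _≟ᵐ_ using (_∈?_)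

m000 m001 m010 m100 m111 : Mask
m000 = mask false false false
m001 = mask false false true
m010 = mask false true  false
m100 = mask true  false false
m111 = mask true  true  true

fullUnion : (Fin 3 → Mask) → Bool
fullUnion m = full (m zero ∪ᵐ m (suc zero) ∪ᵐ m (suc (suc zero)))

bit-∪ᵐ : ∀ m₁ m₂ t → bit (m₁ ∪ᵐ m₂) t ≡ bit m₁ t ∨ bit m₂ t
bit-∪ᵐ (mask _ _ _) (mask _ _ _) zero             = refl
bit-∪ᵐ (mask _ _ _) (mask _ _ _) (suc zero)       = refl
bit-∪ᵐ (mask _ _ _) (mask _ _ _) (suc (suc zero)) = refl

full⇒bit : ∀ m t → T (full m) → T (bit m t)
full⇒bit (mask true true true) zero             _ = _
full⇒bit (mask true true true) (suc zero)       _ = _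
full⇒bit (mask true true true) (suc (suc zero)) _ = _

bit⇒full : ∀ m → (∀ t → T (bit m t)) → T (full m)
bit⇒full (mask b₀ b₁ b₂) h =
  Equivalence.from T-∧ (h zero , Equivalence.from T-∧ (h (suc zero) , h (suc (suc zero))))

T-∨₃ : ∀ (f : Fin 3 → Bool) → T (f zero ∨ f (suc zero) ∨ f (suc (suc zero))) ⇔ ∃ λ i → T (f i)
T-∨₃ f = mk⇔ to from
  where
  to : T (f zero ∨ f (suc zero) ∨ f (suc (suc zero))) → ∃ λ i → T (f i)
  to b with Equivalence.to (T-∨ {f zero}) b
  ... | inj₁ b₀ = zero , b₀
  ... | inj₂ b₁₂ with Equivalence.to (T-∨ {f (suc zero)}) b₁₂
  ...   | inj₁ b₁ = suc zero , b₁
  ...   | inj₂ b₂ = suc (suc zero) , b₂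
  from : ∃ (λ i → T (f i)) → T (f zero ∨ f (suc zero) ∨ f (suc (suc zero)))
  from (zero , b)           = Equivalence.from (T-∨ {f zero}) (inj₁ b)
  from (suc zero , b)       = Equivalence.from (T-∨ {f zero}) (inj₂ (Equivalence.from (T-∨ {f (suc zero)}) (inj₁ b)))
  from (suc (suc zero) , b) = Equivalence.from (T-∨ {f zero}) (inj₂ (Equivalence.from (T-∨ {f (suc zero)}) (inj₂ b)))

T-fullUnion : ∀ m → T (fullUnion m) ⇔ (∀ t → ∃ λ i → T (bit (m i) t))
T-fullUnion m = mk⇔
  (λ h t → Equivalence.to (T-∨₃ (λ i → bit (m i) t)) (subst T (bit-union t) (full⇒bit union t h)))
  (λ h → bit⇒full union λ t → subst T (sym (bit-union t)) (Equivalence.from (T-∨₃ (λ i → bit (m i) t)) (h t)))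
  where
  union : Mask
  union = m zero ∪ᵐ m (suc zero) ∪ᵐ m (suc (suc zero))
  bit-union : ∀ t → bit union t ≡ bit (m zero) t ∨ bit (m (suc zero)) t ∨ bit (m (suc (suc zero))) t
  bit-union t = trans (bit-∪ᵐ (m zero) _ t) (cong (bit (m zero) t ∨_) (bit-∪ᵐ (m (suc zero)) (m (suc (suc zero))) t))

fullUnion-cong : ∀ {m m′ : Fin 3 → Mask} → (∀ i → m i ≡ m′ i) → fullUnion m ≡ fullUnion m′
fullUnion-cong m≡m′ =
  cong₂ (λ a b → full (a ∪ᵐ b)) (m≡m′ zero) (cong₂ _∪ᵐ_ (m≡m′ (suc zero)) (m≡m′ (suc (suc zero))))

coverable : (l₀ l₁ l₂ : List Mask) → Bool
coverable l₀ l₁ l₂ = any (λ m₀ → any (λ m₁ → any (λ m₂ → full (m₀ ∪ᵐ m₁ ∪ᵐ m₂)) l₂) l₁) l₀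

coverable-complete : ∀ (m : Fin 3 → Mask) {l₀ l₁ l₂} → m zero ∈ l₀ → m (suc zero) ∈ l₁ → m (suc (suc zero)) ∈ l₂ →
                     T (fullUnion m) → T (coverable l₀ l₁ l₂)
coverable-complete m m₀∈ m₁∈ m₂∈ h =
  any⁺ _ (Any.map (λ { refl → any⁺ _ (Any.map (λ { refl → any⁺ _ (Any.map (λ { refl → h }) m₂∈) }) m₁∈) }) m₀∈)

-- A profile of a cop position u: its current mask (for the robber staying put) and, for each of the
-- robber's four options j, a list containing every mask the cop can have after its next move.
data Profile : Set where
  profile : (now : Mask) (after₀ after₁ after₂ after₃ : List Mask) → Profile

now : Profile → Mask
now (profile m _ _ _ _) = m

after : Profile → Fin 4 → List Mask
after (profile _ l _ _ _) zero                   = l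
after (profile _ _ l _ _) (suc zero)             = l
after (profile _ _ _ l _) (suc (suc zero))       = l
after (profile _ _ _ _ l) (suc (suc (suc zero))) = l

escapes : Profile → Profile → Profile → Bool
escapes p q r = full (now p ∪ᵐ now q ∪ᵐ now r)
              ∨ any (λ j → not (coverable (after p j) (after q j) (after r j))) (allFin 4)

-- A ball around the robber: the coordinates of its vertices (the robber at `centre`); the first
-- `interiorSize` of them are interior, i.e. have all their neighbours in the ball.
record Certificate : Set where
  field
    size         : ℕ
    coords       : Vec Coord size
    centre       : Fin size
    interiorSize : ℕ
    profiles     : List Profile
    farProfile   : Fin (length profiles)
    profileOf    : Vec (Fin (length profiles)) size

find : ∀ {n} → Vec Coord n → Coord → Maybe (Fin n)
find []       _ = nothing
find (c ∷ cs) d = if isYes (c ≟ᶜ d) then just zero else Maybe.map suc (find cs d)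

NeighbourTable : Certificate → Set
NeighbourTable cert = Vec (Vec (Fin size) 3) size
  where open Certificate cert

neighbourTable : (cert : Certificate) → NeighbourTable cert
neighbourTable cert = tabulate λ x → tabulate λ t → fromMaybe x (find coords (neighbourᶜ (Vec.lookup coords x) t))
  where open Certificate cert

-- The table is a parameter, not a definition inside the module, so that checking `valid` computes it once.
module Ball (cert : Certificate) (table : NeighbourTable cert) where
  open Certificate cert public

  -- `nothing` is a position outside the ball.
  Position : Set
  Position = Maybe (Fin size)

  coord : Fin size → Coord
  coord = Vec.lookup coords

  neighbour : Fin size → Fin 3 → Fin size
  neighbour x = Vec.lookup (Vec.lookup table x)

  interior : Fin size → Bool
  interior x = toℕ x <ᵇ interiorSize

  frontier : Position → Bool
  frontier nothing  = true
  frontier (just x) = not (interior x)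

  adjacentᵇ : Fin size → Fin size → Bool
  adjacentᵇ x y = interior x ∧ any (λ t → isYes (neighbour x t Fin.≟ y)) (allFin 3)

  guardsᵇ : Position → Fin size → Bool
  guardsᵇ nothing  _ = false
  guardsᵇ (just x) y = isYes (x Fin.≟ y) ∨ adjacentᵇ x y ∨ adjacentᵇ y x

  -- Over-approximates the cops' moves (which only helps the cops): every move between positions
  -- that are not interior is allowed.
  moveᵇ : Position → Position → Bool
  moveᵇ u (just y) = guardsᵇ u y ∨ (frontier u ∧ frontier (just y))
  moveᵇ u nothing  = frontier u

  option : Fin 4 → Fin size
  option zero    = centre
  option (suc t) = neighbour centre t

  maskAt : Fin 4 → Position → Mask
  maskAt j u = mask (guardsᵇ u (neighbour (option j) zero)) (guardsᵇ u (neighbour (option j) (suc zero)))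
                    (guardsᵇ u (neighbour (option j) (suc (suc zero))))

  bit-maskAt : ∀ j u t → bit (maskAt j u) t ≡ guardsᵇ u (neighbour (option j) t)
  bit-maskAt j u zero             = refl
  bit-maskAt j u (suc zero)       = refl
  bit-maskAt j u (suc (suc zero)) = refl

  positions : List Position
  positions = nothing ∷ map just (allFin size)

  profileIndex : Position → Fin (length profiles)
  profileIndex nothing  = farProfile
  profileIndex (just x) = Vec.lookup profileOf x

  profileAt : Position → Profile
  profileAt u = lookup profiles (profileIndex u)

  located : Fin size → Fin 3 → Bool
  located x t = isYes (coord (neighbour x t) ≟ᶜ neighbourᶜ (coord x) t)

  complete : Fin size → Bool
  complete x = properᶜ (coord x) ∧ all (located x) (allFin 3)

  optionInterior : Fin 4 → Bool
  optionInterior j = interior (option j) ∧ all (interior ∘ neighbour (option j)) (allFin 3)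

  nowFits : Position → Bool
  nowFits u = isYes (now (profileAt u) ≟ᵐ maskAt zero u)

  afterFits : Position → List Position → Fin 4 → Bool
  afterFits u vs j = all (λ v → isYes (maskAt j v ∈? after (profileAt u) j)) vs

  profileFits : Position → Bool
  profileFits u = nowFits u ∧ all (afterFits u (filterᵇ (moveᵇ u) positions)) (allFin 4)

  interiorComplete optionsInterior profilesFit allTriplesEscape valid : Bool
  interiorComplete = all complete (filterᵇ interior (allFin size))
  optionsInterior  = all optionInterior (allFin 4)
  profilesFit      = all profileFits positions
  allTriplesEscape = all (λ p → all (λ q → all (escapes p q) profiles) profiles) profiles
  valid            = interiorComplete ∧ optionsInterior ∧ profilesFit ∧ allTriplesEscape

allFin⁺ : ∀ {n} (p : Fin n → Bool) → T (all p (allFin n)) → ∀ i → T (p i)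
allFin⁺ p h i = All.lookup (all⁺ p _ h) (∈-allFin i)

anyFin⁺ : ∀ {n} (p : Fin n → Bool) i → T (p i) → T (any p (allFin n))
anyFin⁺ p i h = any⁺ p (Any.map (λ { refl → h }) (∈-allFin i))

module Escape {V : Set} (_~_ : V → V → Set) (~-sym : ∀ {u v} → u ~ v → v ~ u) (_≟ⱽ_ : DecidableEquality V)
  (chart : Coord → V)
  (chart-neighbour : ∀ c t → T (properᶜ c) → chart c ~ chart (neighbourᶜ c t))
  (chart-neighbours-complete : ∀ c → T (properᶜ c) → ∀ v → chart c ~ v → ∃ λ t → chart (neighbourᶜ c t) ≡ v)
  (cert : Certificate) (table : NeighbourTable cert) where

  open Ball cert table

  infix 4 _⟶_
  _⟶_ : V → V → Set
  u ⟶ v = u ≡ v ⊎ u ~ v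

  Guards : V → V → Set
  Guards c v = c ≡ v ⊎ c ~ v

  TrappedBy : (Fin 3 → V) → V → Set
  TrappedBy cops r = ∀ v → r ~ v → ∃ λ i → Guards (cops i) v

  Escapable : (Fin 3 → V) → V → Set
  Escapable cops r = ∃ λ r′ → r ⟶ r′ × (∀ cops′ → (∀ i → cops i ⟶ cops′ i) → ¬ TrappedBy cops′ r′)

  φ : Fin size → V
  φ x = chart (coord x)

  position : V → Position
  position v with Fin.any? (λ x → φ x ≟ⱽ v)
  ... | yes (x , _) = just x
  ... | no _        = nothing

  position-sound : ∀ {v x} → position v ≡ just x → φ x ≡ v
  position-sound {v} eq with Fin.any? (λ x → φ x ≟ⱽ v)
  position-sound refl | yes (_ , φx≡v) = φx≡v

  ∈-positions : ∀ u → u ∈ positions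
  ∈-positions nothing  = here refl
  ∈-positions (just x) = there (∈-map⁺ just (∈-allFin x))

  module _ (φ-injective : ∀ {x y} → φ x ≡ φ y → x ≡ y) (certificate-valid : valid ≡ true) where

    position-φ : ∀ x → position (φ x) ≡ just x
    position-φ x with Fin.any? (λ y → φ y ≟ⱽ φ x)
    ... | yes (y , φy≡φx) = cong just (φ-injective φy≡φx)
    ... | no ∄y           = ⊥-elim (∄y (x , refl))

    valid-parts : T interiorComplete × T optionsInterior × T profilesFit × T allTriplesEscape
    valid-parts = map₂ (map₂ (Equivalence.to (T-∧ {profilesFit})) ∘ Equivalence.to (T-∧ {optionsInterior}))
                    (Equivalence.to (T-∧ {interiorComplete}) (Equivalence.from T-≡ certificate-valid))

    interior-coord : ∀ {x} → T (interior x) → T (properᶜ (coord x)) × (∀ t → coord (neighbour x t) ≡ neighbourᶜ (coord x) t)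
    interior-coord {x} ix = map₂ (λ h t → toWitness (allFin⁺ (located x) h t))
      (Equivalence.to (T-∧ {properᶜ (coord x)})
        (All.lookup (all⁺ complete _ (proj₁ valid-parts)) (∈-filter⁺ (T? ∘ interior) (∈-allFin x) ix)))

    option-interior : ∀ j → T (interior (option j)) × (∀ t → T (interior (neighbour (option j) t)))
    option-interior j = map₂ (allFin⁺ (interior ∘ neighbour (option j)))
      (Equivalence.to (T-∧ {interior (option j)}) (allFin⁺ optionInterior (proj₁ (proj₂ valid-parts)) j))

    φ-neighbour : ∀ {x} → T (interior x) → ∀ t → φ x ~ φ (neighbour x t)
    φ-neighbour {x} ix t =
      subst (λ c → φ x ~ chart c) (sym (proj₂ (interior-coord ix) t)) (chart-neighbour (coord x) t (proj₁ (interior-coord ix)))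

    φ-neighbours-complete : ∀ {x} → T (interior x) → ∀ v → φ x ~ v → ∃ λ t → φ (neighbour x t) ≡ v
    φ-neighbours-complete {x} ix v φx~v =
      let t , e = chart-neighbours-complete (coord x) (proj₁ (interior-coord ix)) v φx~v
      in  t , trans (cong chart (proj₂ (interior-coord ix) t)) e

    adjacentᵇ-sound : ∀ {x y} → T (adjacentᵇ x y) → φ x ~ φ y
    adjacentᵇ-sound {x} {y} h =
      let ix , some-t = Equivalence.to (T-∧ {interior x}) h
          t , nb≡y    = satisfied (any⁻ (λ t → isYes (neighbour x t Fin.≟ y)) (allFin 3) some-t)
      in  subst (λ z → φ x ~ φ z) (toWitness nb≡y) (φ-neighbour ix t)

    adjacentᵇ-neighbour : ∀ {x} → T (interior x) → ∀ t → T (adjacentᵇ x (neighbour x t))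
    adjacentᵇ-neighbour {x} ix t =
      Equivalence.from T-∧ (ix , anyFin⁺ (λ t′ → isYes (neighbour x t′ Fin.≟ neighbour x t)) t (fromWitness refl))

    guardsᵇ-sound : ∀ {c w} → T (guardsᵇ (position c) w) → Guards c (φ w)
    guardsᵇ-sound {c} {w} h with position c in pc
    ... | just x with Equivalence.to (T-∨ {isYes (x Fin.≟ w)}) h
    ...   | inj₁ x≡w = inj₁ (trans (sym (position-sound pc)) (cong φ (toWitness x≡w)))
    ...   | inj₂ h′ with Equivalence.to (T-∨ {adjacentᵇ x w}) h′
    ...     | inj₁ x~w = inj₂ (subst (_~ φ w) (position-sound pc) (adjacentᵇ-sound x~w))
    ...     | inj₂ w~x = inj₂ (subst (_~ φ w) (position-sound pc) (~-sym (adjacentᵇ-sound w~x)))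

    guardsᵇ-complete : ∀ {c w} → T (interior w) → Guards c (φ w) → T (guardsᵇ (position c) w)
    guardsᵇ-complete {w = w} iw (inj₁ refl) rewrite position-φ w =
      Equivalence.from (T-∨ {isYes (w Fin.≟ w)}) (inj₁ (fromWitness refl))
    guardsᵇ-complete {c} {w} iw (inj₂ c~φw) with φ-neighbours-complete iw c (~-sym c~φw)
    ... | t , refl rewrite position-φ (neighbour w t) =
      Equivalence.from (T-∨ {isYes (neighbour w t Fin.≟ w)})
        (inj₂ (Equivalence.from (T-∨ {adjacentᵇ (neighbour w t) w}) (inj₂ (adjacentᵇ-neighbour iw t))))

    guardsᵇ-neighbour : ∀ {x} → T (interior x) → ∀ t → T (guardsᵇ (just x) (neighbour x t))
    guardsᵇ-neighbour {x} ix t =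
      Equivalence.from (T-∨ {isYes (x Fin.≟ neighbour x t)}) (inj₂ (Equivalence.from T-∨ (inj₁ (adjacentᵇ-neighbour ix t))))

    moveᵇ-guards : ∀ {u y} → T (guardsᵇ u y) → T (moveᵇ u (just y))
    moveᵇ-guards h = Equivalence.from T-∨ (inj₁ h)

    moveᵇ-frontier : ∀ {u v} → T (frontier u) → T (frontier v) → T (moveᵇ u v)
    moveᵇ-frontier {u} {just y}  fu fv = Equivalence.from (T-∨ {guardsᵇ u y}) (inj₂ (Equivalence.from T-∧ (fu , fv)))
    moveᵇ-frontier {u} {nothing} fu _  = fu

    moveᵇ-refl : ∀ u → T (moveᵇ u u)
    moveᵇ-refl nothing  = _
    moveᵇ-refl (just x) = moveᵇ-guards (Equivalence.from (T-∨ {isYes (x Fin.≟ x)}) (inj₁ (fromWitness refl)))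

    frontier-or-interior : ∀ u → T (frontier u) ⊎ ∃ λ x → u ≡ just x × T (interior x)
    frontier-or-interior nothing = inj₁ _
    frontier-or-interior (just x) with interior x in ix
    ... | true  = inj₂ (x , refl , subst T (sym ix) _)
    ... | false = inj₁ _

    moveᵇ-complete : ∀ {c c′} → c ⟶ c′ → T (moveᵇ (position c) (position c′))
    moveᵇ-complete {c} (inj₁ refl) = moveᵇ-refl (position c)
    moveᵇ-complete {c} {c′} (inj₂ c~c′) with frontier-or-interior (position c) | frontier-or-interior (position c′)
    ... | inj₂ (x , pc , ix) | _ with φ-neighbours-complete ix c′ (subst (_~ c′) (sym (position-sound pc)) c~c′)
    ...   | t , refl rewrite pc | position-φ (neighbour x t) = moveᵇ-guards (guardsᵇ-neighbour ix t)
    moveᵇ-complete {c} {c′} (inj₂ c~c′) | _ | inj₂ (y , pc′ , iy) rewrite pc′ =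
      moveᵇ-guards {position c} (guardsᵇ-complete iy (inj₂ (subst (c ~_) (sym (position-sound pc′)) c~c′)))
    moveᵇ-complete {c} {c′} (inj₂ _) | inj₁ fc | inj₁ fc′ = moveᵇ-frontier {position c} {position c′} fc fc′

    profile-fits : ∀ u → T (nowFits u) × T (all (afterFits u (filterᵇ (moveᵇ u) positions)) (allFin 4))
    profile-fits u = Equivalence.to (T-∧ {nowFits u}) (All.lookup (all⁺ profileFits _ (proj₁ (proj₂ (proj₂ valid-parts)))) (∈-positions u))

    profile-now : ∀ u → now (profileAt u) ≡ maskAt zero u
    profile-now u = toWitness (proj₁ (profile-fits u))

    profile-after : ∀ u v j → T (moveᵇ u v) → maskAt j v ∈ after (profileAt u) j
    profile-after u v j u→v =
      toWitness (All.lookup (all⁺ _ _ (allFin⁺ (afterFits u (filterᵇ (moveᵇ u) positions)) (proj₂ (profile-fits u)) j))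
                            (∈-filter⁺ (T? ∘ moveᵇ u) (∈-positions v) u→v))

    profiles-escape : ∀ u₀ u₁ u₂ → T (escapes (profileAt u₀) (profileAt u₁) (profileAt u₂))
    profiles-escape u₀ u₁ u₂ = all-escape (∈-lookup (profileIndex u₀)) (∈-lookup (profileIndex u₁)) (∈-lookup (profileIndex u₂))
      where
      all-escape : ∀ {p q r} → p ∈ profiles → q ∈ profiles → r ∈ profiles → T (escapes p q r)
      all-escape {p} {q} p∈ q∈ r∈ =
        All.lookup (all⁺ (escapes p q) profiles
          (All.lookup (all⁺ (λ q → all (escapes p q) profiles) profiles
            (All.lookup (all⁺ (λ p → all (λ q → all (escapes p q) profiles) profiles) profiles
              (proj₂ (proj₂ (proj₂ valid-parts)))) p∈)) q∈)) r∈

    masks-cover⇒trapped : ∀ cops j → T (fullUnion (λ i → maskAt j (position (cops i)))) → TrappedBy cops (φ (option j))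
    masks-cover⇒trapped cops j h v r~v =
      let t , e = φ-neighbours-complete (proj₁ (option-interior j)) v r~v
          i , b = Equivalence.to (T-fullUnion (λ i → maskAt j (position (cops i)))) h t
      in  i , subst (Guards (cops i)) e (guardsᵇ-sound (subst T (bit-maskAt j (position (cops i)) t) b))

    trapped⇒masks-cover : ∀ cops j → TrappedBy cops (φ (option j)) → T (fullUnion (λ i → maskAt j (position (cops i))))
    trapped⇒masks-cover cops j trapped = Equivalence.from (T-fullUnion (λ i → maskAt j (position (cops i)))) λ t →
      let i , guards = trapped _ (φ-neighbour (proj₁ (option-interior j)) t)
      in  i , subst T (sym (bit-maskAt j (position (cops i)) t)) (guardsᵇ-complete (proj₂ (option-interior j) t) guards)

    robber-move : ∀ j → φ centre ⟶ φ (option j)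
    robber-move zero    = inj₁ refl
    robber-move (suc t) = inj₂ (φ-neighbour (proj₁ (option-interior zero)) t)

    escape : ∀ cops → ¬ TrappedBy cops (φ centre) → Escapable cops (φ centre)
    escape cops free = [ stuck , flee ∘ satisfied ∘ any⁻ uncoverable (allFin 4) ]′
                         (Equivalence.to T-∨ (profiles-escape (u zero) (u (suc zero)) (u (suc (suc zero)))))
      where
      u : Fin 3 → Position
      u = position ∘ cops
      p : Fin 3 → Profile
      p = profileAt ∘ u
      stuck : T (fullUnion (now ∘ p)) → Escapable cops (φ centre)
      stuck guarded = ⊥-elim (free (masks-cover⇒trapped cops zero (subst T (fullUnion-cong (profile-now ∘ u)) guarded)))
      uncoverable : Fin 4 → Bool
      uncoverable j = not (coverable (after (p zero) j) (after (p (suc zero)) j) (after (p (suc (suc zero))) j))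
      flee : ∃ (T ∘ uncoverable) → Escapable cops (φ centre)
      flee (j , j-uncoverable) = φ (option j) , robber-move j , λ cops′ moves trapped →
        subst T (Equivalence.to T-not-≡ j-uncoverable)
          (coverable-complete (λ i → maskAt j (position (cops′ i)))
            (reachable cops′ moves zero) (reachable cops′ moves (suc zero)) (reachable cops′ moves (suc (suc zero)))
            (trapped⇒masks-cover cops′ j trapped))
        where
        reachable : ∀ cops′ → (∀ i → cops i ⟶ cops′ i) → ∀ i → maskAt j (position (cops′ i)) ∈ after (p i) j
        reachable cops′ moves i = profile-after (u i) (position (cops′ i)) j (moveᵇ-complete (moves i))

CollisionFree : (n k : ℕ) .{{_ : NonZero n}} → ∀ {size} → Vec Coord size → Set
CollisionFree n k cs = ∀ {x y} → T (sameSide (Vec.lookup cs x) (Vec.lookup cs y)) →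
                       offset k (Vec.lookup cs x) % n ≡ offset k (Vec.lookup cs y) % n → x ≡ y

pairApart : ∀ {size} → (Coord → Coord → Bool) → Vec Coord size → Fin size → Fin size → Bool
pairApart apart cs x y = isYes (x Fin.≟ y) ∨ not (sameSide (Vec.lookup cs x) (Vec.lookup cs y))
                                           ∨ apart (Vec.lookup cs x) (Vec.lookup cs y)

pairwise : ∀ {size} → (Coord → Coord → Bool) → Vec Coord size → Bool
pairwise apart cs = all (λ x → all (pairApart apart cs x) (allFin _)) (allFin _)

T-not : ∀ {b} → T (not b) → ¬ T b
T-not {true} ()

collisionFree-pairwise : ∀ {n k} .{{_ : NonZero n}} {size} (apart : Coord → Coord → Bool) →
                         (∀ c c′ → T (apart c c′) → offset k c % n ≢ offset k c′ % n) →
                         (cs : Vec Coord size) → T (pairwise apart cs) → CollisionFree n k cs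
collisionFree-pairwise apart apart-sound cs h {x} {y} same eq =
  [ toWitness , (λ h′ → [ (λ different → ⊥-elim (T-not different same)) , (λ a → ⊥-elim (apart-sound cx cy a eq)) ]′
                          (Equivalence.to (T-∨ {not (sameSide cx cy)}) h′)) ]′
    (Equivalence.to (T-∨ {isYes (x Fin.≟ y)}) (allFin⁺ (pairApart apart cs x) (allFin⁺ _ h x) y))
  where
  cx cy : Coord
  cx = Vec.lookup cs x
  cy = Vec.lookup cs y

apartMod : (n k : ℕ) .{{_ : NonZero n}} → Coord → Coord → Bool
apartMod n k c c′ = not (offset k c % n ≡ᵇ offset k c′ % n)

apartMod-sound : ∀ {n k} .{{_ : NonZero n}} c c′ → T (apartMod n k c c′) → offset k c % n ≢ offset k c′ % n
apartMod-sound _ _ h eq = T-not h (≡⇒≡ᵇ _ _ eq)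

-- Each of these forces two ball coordinates to have different offsets when n = 7m, k = cm and m ≥ 6.
distinctSteps : ℕ → Coord → Coord → Bool
distinctSteps c x y = (column x ≡ᵇ column y) ∧ not (step x * c % 7 ≡ᵇ step y * c % 7)

distinctColumns : Coord → Coord → Bool
distinctColumns x y = (step x ≡ᵇ step y) ∧ not (column x ≡ᵇ column y) ∧ (column x <ᵇ 9) ∧ (column y <ᵇ 9)

nearColumns : Coord → Coord → Bool
nearColumns x y = (column y <ᵇ column x) ∧ (column x <ᵇ column y + 6)

apart₇ : ℕ → Coord → Coord → Bool
apart₇ c x y = distinctSteps c x y ∨ distinctColumns x y ∨ nearColumns x y ∨ nearColumns y x

module Sevenfold (m′ c : ℕ) (5≤m′ : 5 ≤ m′) where

  private
    m n k : ℕ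
    m = suc m′
    n = 7 * m
    k = c * m

    step-multiple : ∀ s → s * k ≡ s * c * m
    step-multiple s = sym (*-assoc s c m)

  distinctSteps-apart : ∀ x y → T (distinctSteps c x y) → offset k x % n ≢ offset k y % n
  distinctSteps-apart x y h eq = T-not steps-differ (≡⇒≡ᵇ (s * c % 7) (s′ * c % 7) (*-cancelʳ-≡ _ _ m (begin
    s * c % 7 * m     ≡⟨ m%n*o≡m*o%[n*o] (s * c) 7 m ⟩
    s * c * m % n     ≡⟨ cong (_% n) (step-multiple s) ⟨
    s * k % n         ≡⟨ +-cancelˡ-% A _ _ (trans eq (cong (λ B → (B + s′ * k) % n) (sym same-column))) ⟩
    s′ * k % n        ≡⟨ cong (_% n) (step-multiple s′) ⟩
    s′ * c * m % n    ≡⟨ m%n*o≡m*o%[n*o] (s′ * c) 7 m ⟨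
    s′ * c % 7 * m    ∎)))
    where
    open ≡-Reasoning
    A s s′ : ℕ
    A = column x
    s = step x
    s′ = step y
    same-column : A ≡ column y
    same-column = ≡ᵇ⇒≡ A (column y) (proj₁ (Equivalence.to (T-∧ {A ≡ᵇ column y}) h))
    steps-differ : T (not (s * c % 7 ≡ᵇ s′ * c % 7))
    steps-differ = proj₂ (Equivalence.to (T-∧ {A ≡ᵇ column y}) h)

  distinctColumns-apart : ∀ x y → T (distinctColumns x y) → offset k x % n ≢ offset k y % n
  distinctColumns-apart x y h eq =
    let same-step , h′         = Equivalence.to (T-∧ {step x ≡ᵇ step y}) h
        columns-differ , h″    = Equivalence.to (T-∧ {not (column x ≡ᵇ column y)}) h′
        x<9 , y<9              = Equivalence.to (T-∧ {column x <ᵇ 9}) h″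
    in  T-not columns-differ (≡⇒≡ᵇ (column x) (column y)
          (+-cancelʳ-%-< (step x * k) (<-≤-trans (<ᵇ⇒< (column x) 9 x<9) 9≤n) (<-≤-trans (<ᵇ⇒< (column y) 9 y<9) 9≤n)
            (trans eq (cong (λ t → (column y + t * k) % n) (sym (≡ᵇ⇒≡ (step x) (step y) same-step))))))
    where
    9≤n : 9 ≤ n
    9≤n = ≤-trans (m≤m+n 9 33) (*-monoʳ-≤ 7 (s≤s 5≤m′))

  -- Modulo m the offset A + s·k is just A, and two columns less than six apart differ modulo m ≥ 6.
  nearColumns-apart : ∀ x y → T (nearColumns x y) → offset k x % n ≢ offset k y % n
  nearColumns-apart x y h eq = <⇒≢ δ>0 (sym δ≡0)
    where
    A A′ δ : ℕ
    A  = column x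
    A′ = column y
    δ  = A ∸ A′
    A′<A : A′ < A
    A′<A = <ᵇ⇒< A′ A (proj₁ (Equivalence.to (T-∧ {A′ <ᵇ A}) h))
    A<A′+6 : A < A′ + 6
    A<A′+6 = <ᵇ⇒< A (A′ + 6) (proj₂ (Equivalence.to (T-∧ {A′ <ᵇ A}) h))
    δ>0 : 0 < δ
    δ>0 = m<n⇒0<n∸m A′<A
    δ<m : δ < m
    δ<m = s≤s (≤-trans (∸-monoˡ-≤ A′ (s≤s⁻¹ (≤-trans A<A′+6 (≤-reflexive (+-comm A′ 6)))))
                       (≤-trans (≤-reflexive (m+n∸n≡m 5 A′)) 5≤m′))
    column-residue : ∀ B t → (B + t * k) % n % m ≡ B % m
    column-residue B t = begin
      (B + t * k) % n % m       ≡⟨ m∣n⇒o%n%m≡o%m m n (B + t * k) (divides 7 refl) ⟩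
      (B + t * k) % m           ≡⟨ cong (λ z → (B + z) % m) (step-multiple t) ⟩
      (B + t * c * m) % m       ≡⟨ [m+kn]%n≡m%n B (t * c) m ⟩
      B % m                     ∎
      where open ≡-Reasoning
    δ≡0 : δ ≡ 0
    δ≡0 = begin
      δ                   ≡⟨ m<n⇒m%n≡m δ<m ⟨
      δ % m               ≡⟨ +-cancelˡ-% A′ δ 0 (begin
        (A′ + δ) % m              ≡⟨ cong (_% m) (m+[n∸m]≡n (<⇒≤ A′<A)) ⟩
        A % m                     ≡⟨ column-residue A (step x) ⟨
        offset k x % n % m        ≡⟨ cong (_% m) eq ⟩
        offset k y % n % m        ≡⟨ column-residue A′ (step y) ⟩
        A′ % m                    ≡⟨ cong (_% m) (+-identityʳ A′) ⟨
        (A′ + 0) % m              ∎) ⟩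
      0                   ∎
      where open ≡-Reasoning

  apart₇-sound : ∀ x y → T (apart₇ c x y) → offset k x % n ≢ offset k y % n
  apart₇-sound x y h with Equivalence.to (T-∨ {distinctSteps c x y}) h
  ... | inj₁ h₁ = distinctSteps-apart x y h₁
  ... | inj₂ h₂ with Equivalence.to (T-∨ {distinctColumns x y}) h₂
  ...   | inj₁ h₃ = distinctColumns-apart x y h₃
  ...   | inj₂ h₄ with Equivalence.to (T-∨ {nearColumns x y}) h₄
  ...     | inj₁ h₅ = nearColumns-apart x y h₅
  ...     | inj₂ h₆ = nearColumns-apart y x h₆ ∘ sym

  collisionFree : ∀ {size} (cs : Vec Coord size) → T (pairwise (apart₇ c) cs) → CollisionFree n k cs
  collisionFree = collisionFree-pairwise (apart₇ c) apart₇-sound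

outerCertificate : Certificate
outerCertificate = record
  { size         = 42
  ; coords       = outerᶜ 4 0 ∷ outerᶜ 3 0 ∷ outerᶜ 5 0 ∷ innerᶜ 4 0 ∷ outerᶜ 2 0 ∷ outerᶜ 6 0 ∷ innerᶜ 3 0 ∷
                   innerᶜ 4 1 ∷ innerᶜ 4 6 ∷ innerᶜ 5 0 ∷ outerᶜ 1 0 ∷ outerᶜ 4 1 ∷ outerᶜ 4 6 ∷ outerᶜ 7 0 ∷
                   innerᶜ 2 0 ∷ innerᶜ 3 1 ∷ innerᶜ 3 6 ∷ innerᶜ 4 2 ∷ innerᶜ 4 5 ∷ innerᶜ 5 1 ∷ innerᶜ 5 6 ∷
                   innerᶜ 6 0 ∷ outerᶜ 0 0 ∷ outerᶜ 3 1 ∷ outerᶜ 3 6 ∷ outerᶜ 4 2 ∷ outerᶜ 4 5 ∷ outerᶜ 5 1 ∷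
                   outerᶜ 5 6 ∷ outerᶜ 8 0 ∷ innerᶜ 1 0 ∷ innerᶜ 2 1 ∷ innerᶜ 2 6 ∷ innerᶜ 3 2 ∷ innerᶜ 3 5 ∷
                   innerᶜ 4 3 ∷ innerᶜ 4 4 ∷ innerᶜ 5 2 ∷ innerᶜ 5 5 ∷ innerᶜ 6 1 ∷ innerᶜ 6 6 ∷ innerᶜ 7 0 ∷ []
  ; centre       = # 0
  ; interiorSize = 22
  ; profiles     = profile m000 (m000 ∷ []) (m000 ∷ []) (m000 ∷ []) (m000 ∷ []) ∷
                   profile m111 (m001 ∷ m010 ∷ m100 ∷ m111 ∷ []) (m010 ∷ m111 ∷ []) (m100 ∷ m111 ∷ []) (m100 ∷ m111 ∷ []) ∷
                   profile m010 (m010 ∷ m111 ∷ []) (m000 ∷ m010 ∷ []) (m001 ∷ m010 ∷ m100 ∷ m111 ∷ []) (m000 ∷ m100 ∷ []) ∷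
                   profile m100 (m100 ∷ m111 ∷ []) (m001 ∷ m010 ∷ m100 ∷ m111 ∷ []) (m000 ∷ m100 ∷ []) (m000 ∷ m100 ∷ []) ∷
                   profile m001 (m001 ∷ m111 ∷ []) (m000 ∷ m010 ∷ []) (m000 ∷ m100 ∷ []) (m001 ∷ m010 ∷ m100 ∷ m111 ∷ []) ∷
                   profile m010 (m000 ∷ m010 ∷ []) (m000 ∷ m010 ∷ []) (m010 ∷ m111 ∷ []) (m000 ∷ m100 ∷ []) ∷
                   profile m100 (m000 ∷ m100 ∷ []) (m100 ∷ m111 ∷ []) (m000 ∷ m100 ∷ []) (m000 ∷ m100 ∷ []) ∷
                   profile m010 (m000 ∷ m010 ∷ []) (m000 ∷ m010 ∷ []) (m001 ∷ m111 ∷ []) (m000 ∷ m100 ∷ []) ∷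
                   profile m001 (m000 ∷ m001 ∷ []) (m000 ∷ m010 ∷ []) (m000 ∷ m100 ∷ []) (m010 ∷ m111 ∷ []) ∷
                   profile m001 (m000 ∷ m001 ∷ []) (m000 ∷ m010 ∷ []) (m000 ∷ m100 ∷ []) (m001 ∷ m111 ∷ []) ∷
                   profile m100 (m000 ∷ m100 ∷ []) (m001 ∷ m111 ∷ []) (m000 ∷ m100 ∷ []) (m000 ∷ m100 ∷ []) ∷
                   profile m000 (m000 ∷ m010 ∷ []) (m000 ∷ []) (m000 ∷ m010 ∷ []) (m000 ∷ []) ∷
                   profile m000 (m000 ∷ m001 ∷ []) (m000 ∷ []) (m000 ∷ []) (m000 ∷ m010 ∷ []) ∷
                   profile m000 (m000 ∷ m001 ∷ []) (m000 ∷ []) (m000 ∷ []) (m000 ∷ m001 ∷ []) ∷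
                   profile m000 (m000 ∷ m100 ∷ []) (m000 ∷ m100 ∷ []) (m000 ∷ []) (m000 ∷ []) ∷
                   profile m000 (m000 ∷ m010 ∷ []) (m000 ∷ []) (m000 ∷ m001 ∷ []) (m000 ∷ []) ∷
                   profile m000 (m000 ∷ m100 ∷ []) (m000 ∷ m001 ∷ []) (m000 ∷ []) (m000 ∷ []) ∷
                   profile m000 (m000 ∷ []) (m000 ∷ []) (m000 ∷ m010 ∷ []) (m000 ∷ []) ∷
                   profile m000 (m000 ∷ []) (m000 ∷ []) (m000 ∷ m001 ∷ []) (m000 ∷ m010 ∷ []) ∷
                   profile m000 (m000 ∷ []) (m000 ∷ []) (m000 ∷ m001 ∷ []) (m000 ∷ m001 ∷ []) ∷
                   profile m000 (m000 ∷ []) (m000 ∷ []) (m000 ∷ []) (m000 ∷ m010 ∷ []) ∷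
                   profile m000 (m000 ∷ []) (m000 ∷ []) (m000 ∷ []) (m000 ∷ m001 ∷ []) ∷
                   profile m000 (m000 ∷ []) (m000 ∷ m001 ∷ []) (m000 ∷ []) (m000 ∷ m010 ∷ []) ∷
                   profile m000 (m000 ∷ []) (m000 ∷ m001 ∷ []) (m000 ∷ []) (m000 ∷ m001 ∷ []) ∷
                   profile m000 (m000 ∷ []) (m000 ∷ m100 ∷ []) (m000 ∷ []) (m000 ∷ []) ∷
                   profile m000 (m000 ∷ []) (m000 ∷ []) (m000 ∷ m001 ∷ []) (m000 ∷ []) ∷
                   profile m000 (m000 ∷ []) (m000 ∷ m001 ∷ []) (m000 ∷ []) (m000 ∷ []) ∷
                   []
  ; farProfile   = # 0
  ; profileOf    = # 1 ∷ # 2 ∷ # 3 ∷ # 4 ∷ # 5 ∷ # 6 ∷ # 7 ∷ # 8 ∷ # 9 ∷ # 10 ∷ # 11 ∷ # 12 ∷ # 13 ∷ # 14 ∷ # 11 ∷ # 15 ∷ # 15 ∷ # 12 ∷ # 13 ∷ # 16 ∷ # 16 ∷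
                   # 14 ∷ # 17 ∷ # 18 ∷ # 19 ∷ # 20 ∷ # 21 ∷ # 22 ∷ # 23 ∷ # 24 ∷ # 17 ∷ # 17 ∷ # 17 ∷ # 25 ∷ # 25 ∷ # 20 ∷ # 21 ∷ # 26 ∷ # 26 ∷ # 24 ∷ # 24 ∷ # 24 ∷ []
  }

innerCertificate : Certificate
innerCertificate = record
  { size         = 40
  ; coords       = innerᶜ 4 0 ∷ outerᶜ 4 0 ∷ innerᶜ 4 1 ∷ innerᶜ 4 6 ∷ outerᶜ 3 0 ∷ outerᶜ 4 1 ∷ outerᶜ 4 6 ∷
                   outerᶜ 5 0 ∷ innerᶜ 4 2 ∷ innerᶜ 4 5 ∷ outerᶜ 2 0 ∷ outerᶜ 3 1 ∷ outerᶜ 3 6 ∷ outerᶜ 4 2 ∷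
                   outerᶜ 4 5 ∷ outerᶜ 5 1 ∷ outerᶜ 5 6 ∷ outerᶜ 6 0 ∷ innerᶜ 3 0 ∷ innerᶜ 4 3 ∷ innerᶜ 4 4 ∷
                   innerᶜ 5 0 ∷ outerᶜ 1 0 ∷ outerᶜ 2 1 ∷ outerᶜ 2 6 ∷ outerᶜ 3 2 ∷ outerᶜ 3 5 ∷ outerᶜ 4 3 ∷
                   outerᶜ 4 4 ∷ outerᶜ 5 2 ∷ outerᶜ 5 5 ∷ outerᶜ 6 1 ∷ outerᶜ 6 6 ∷ outerᶜ 7 0 ∷ innerᶜ 2 0 ∷
                   innerᶜ 3 1 ∷ innerᶜ 3 6 ∷ innerᶜ 5 1 ∷ innerᶜ 5 6 ∷ innerᶜ 6 0 ∷ []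
  ; centre       = # 0
  ; interiorSize = 22
  ; profiles     = profile m000 (m000 ∷ []) (m000 ∷ []) (m000 ∷ []) (m000 ∷ []) ∷
                   profile m111 (m001 ∷ m010 ∷ m100 ∷ m111 ∷ []) (m001 ∷ m111 ∷ []) (m001 ∷ m111 ∷ []) (m010 ∷ m111 ∷ []) ∷
                   profile m100 (m100 ∷ m111 ∷ []) (m001 ∷ m010 ∷ m100 ∷ m111 ∷ []) (m000 ∷ m001 ∷ []) (m000 ∷ m010 ∷ []) ∷
                   profile m010 (m010 ∷ m111 ∷ []) (m000 ∷ m001 ∷ []) (m001 ∷ m010 ∷ m100 ∷ m111 ∷ []) (m000 ∷ m010 ∷ []) ∷
                   profile m001 (m001 ∷ m111 ∷ []) (m000 ∷ m001 ∷ []) (m000 ∷ m001 ∷ []) (m001 ∷ m010 ∷ m100 ∷ m111 ∷ []) ∷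
                   profile m100 (m000 ∷ m100 ∷ []) (m010 ∷ m111 ∷ []) (m000 ∷ m001 ∷ []) (m000 ∷ m010 ∷ []) ∷
                   profile m010 (m000 ∷ m010 ∷ []) (m000 ∷ m001 ∷ []) (m100 ∷ m111 ∷ []) (m000 ∷ m010 ∷ []) ∷
                   profile m001 (m000 ∷ m001 ∷ []) (m000 ∷ m001 ∷ []) (m000 ∷ m001 ∷ []) (m100 ∷ m111 ∷ []) ∷
                   profile m100 (m000 ∷ m100 ∷ []) (m100 ∷ m111 ∷ []) (m000 ∷ m001 ∷ []) (m000 ∷ m010 ∷ []) ∷
                   profile m010 (m000 ∷ m010 ∷ []) (m000 ∷ m001 ∷ []) (m010 ∷ m111 ∷ []) (m000 ∷ m010 ∷ []) ∷
                   profile m001 (m000 ∷ m001 ∷ []) (m000 ∷ m001 ∷ []) (m000 ∷ m001 ∷ []) (m001 ∷ m111 ∷ []) ∷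
                   profile m000 (m000 ∷ m100 ∷ []) (m000 ∷ m010 ∷ []) (m000 ∷ []) (m000 ∷ []) ∷
                   profile m000 (m000 ∷ m010 ∷ []) (m000 ∷ []) (m000 ∷ m100 ∷ []) (m000 ∷ []) ∷
                   profile m000 (m000 ∷ m001 ∷ []) (m000 ∷ []) (m000 ∷ []) (m000 ∷ m100 ∷ []) ∷
                   profile m000 (m000 ∷ m010 ∷ []) (m000 ∷ []) (m000 ∷ m010 ∷ []) (m000 ∷ []) ∷
                   profile m000 (m000 ∷ m001 ∷ []) (m000 ∷ []) (m000 ∷ []) (m000 ∷ m001 ∷ []) ∷
                   profile m000 (m000 ∷ m100 ∷ []) (m000 ∷ m100 ∷ []) (m000 ∷ []) (m000 ∷ []) ∷
                   profile m000 (m000 ∷ m010 ∷ []) (m000 ∷ []) (m000 ∷ m010 ∷ []) (m000 ∷ m001 ∷ []) ∷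
                   profile m000 (m000 ∷ m001 ∷ []) (m000 ∷ []) (m000 ∷ m010 ∷ []) (m000 ∷ m001 ∷ []) ∷
                   profile m000 (m000 ∷ []) (m000 ∷ m010 ∷ []) (m000 ∷ []) (m000 ∷ []) ∷
                   profile m000 (m000 ∷ []) (m000 ∷ []) (m000 ∷ m100 ∷ []) (m000 ∷ []) ∷
                   profile m000 (m000 ∷ []) (m000 ∷ []) (m000 ∷ []) (m000 ∷ m100 ∷ []) ∷
                   profile m000 (m000 ∷ []) (m000 ∷ []) (m000 ∷ m010 ∷ []) (m000 ∷ []) ∷
                   profile m000 (m000 ∷ []) (m000 ∷ []) (m000 ∷ []) (m000 ∷ m001 ∷ []) ∷
                   profile m000 (m000 ∷ []) (m000 ∷ m100 ∷ []) (m000 ∷ []) (m000 ∷ []) ∷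
                   profile m000 (m000 ∷ []) (m000 ∷ m010 ∷ []) (m000 ∷ m100 ∷ []) (m000 ∷ []) ∷
                   profile m000 (m000 ∷ []) (m000 ∷ m010 ∷ []) (m000 ∷ []) (m000 ∷ m100 ∷ []) ∷
                   profile m000 (m000 ∷ []) (m000 ∷ m100 ∷ []) (m000 ∷ m100 ∷ []) (m000 ∷ []) ∷
                   profile m000 (m000 ∷ []) (m000 ∷ m100 ∷ []) (m000 ∷ []) (m000 ∷ m100 ∷ []) ∷
                   []
  ; farProfile   = # 0
  ; profileOf    = # 1 ∷ # 2 ∷ # 3 ∷ # 4 ∷ # 5 ∷ # 6 ∷ # 7 ∷ # 8 ∷ # 9 ∷ # 10 ∷ # 11 ∷ # 12 ∷ # 13 ∷ # 14 ∷ # 15 ∷ # 12 ∷ # 13 ∷ # 16 ∷ # 11 ∷ # 17 ∷ # 18 ∷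
                   # 16 ∷ # 19 ∷ # 20 ∷ # 21 ∷ # 22 ∷ # 23 ∷ # 22 ∷ # 23 ∷ # 22 ∷ # 23 ∷ # 20 ∷ # 21 ∷ # 24 ∷ # 19 ∷ # 25 ∷ # 26 ∷ # 27 ∷ # 28 ∷ # 24 ∷ []
  }

-- Stated with ≡ true rather than T, so that using these proofs does not re-run the check.
outer-valid : Ball.valid outerCertificate (neighbourTable outerCertificate) ≡ true
outer-valid = refl

inner-valid : Ball.valid innerCertificate (neighbourTable innerCertificate) ≡ true
inner-valid = refl

BallsCollisionFree : (n k : ℕ) .{{_ : NonZero n}} → Set
BallsCollisionFree n k = CollisionFree n k (Certificate.coords outerCertificate)
                       × CollisionFree n k (Certificate.coords innerCertificate)

module GeneralisedPetersen (n k : ℕ) .{{_ : NonZero n}} (4≤n : 4 ≤ n) (n∣7k : n ∣ 7 * k) where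

  Escapable : Cops n → Vertex n → Set
  Escapable cops r = ∃ λ r′ → Move n k r r′ ×
    ((cops′ : Cops n) → (∀ c → Move n k (cops c) (cops′ c)) → ¬ Trapped n k cops′ r′)

  escape-at : ∀ cert → CollisionFree n k (Certificate.coords cert) → Ball.valid cert (neighbourTable cert) ≡ true →
              ∀ p cops → let r = Chart.chart n k 4≤n n∣7k p (Ball.coord cert (neighbourTable cert) (Certificate.centre cert))
                         in ¬ Trapped n k cops r → Escapable cops r
  escape-at cert collision-free valid p = E.escape φ-injective valid
    where
    open Chart n k 4≤n n∣7k p
    module E = Escape (Adj n k) Adj-sym _≟ᵛ_ chart chart-neighbour chart-neighbours-complete cert (neighbourTable cert)
    φ-injective : ∀ {x y} → E.φ x ≡ E.φ y → x ≡ y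
    φ-injective eq = let same , offsets = chart-collision _ _ eq in collision-free same offsets

  centre-at : ∀ i → Chart.at n k 4≤n n∣7k (toℕ i) 4 0 ≡ i
  centre-at i = toℕ-injective (trans (Chart.at-centre n k 4≤n n∣7k (toℕ i)) (m<n⇒m%n≡m (toℕ<n i)))

  escape : BallsCollisionFree n k → ∀ r cops → ¬ Trapped n k cops r → Escapable cops r
  escape (outer-free , _) (outer i) cops =
    subst (λ r → ¬ Trapped n k cops r → Escapable cops r) (cong outer (centre-at i))
      (escape-at outerCertificate outer-free outer-valid (toℕ i) cops)
  escape (_ , inner-free) (inner i) cops =
    subst (λ r → ¬ Trapped n k cops r → Escapable cops r) (cong inner (centre-at i))
      (escape-at innerCertificate inner-free inner-valid (toℕ i) cops)

ballsCollisionFree-mod : ∀ n k .{{_ : NonZero n}} →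
                         T (pairwise (apartMod n k) (Certificate.coords outerCertificate)) →
                         T (pairwise (apartMod n k) (Certificate.coords innerCertificate)) → BallsCollisionFree n k
ballsCollisionFree-mod n k outer-apart inner-apart =
    collisionFree-pairwise (apartMod n k) apartMod-sound (Certificate.coords outerCertificate) outer-apart
  , collisionFree-pairwise (apartMod n k) apartMod-sound (Certificate.coords innerCertificate) inner-apart

ballsCollisionFree-sevenfold : ∀ {n k} .{{_ : NonZero n}} m c → n ≡ 7 * m → k ≡ c * m → 6 ≤ m →
                               T (pairwise (apart₇ c) (Certificate.coords outerCertificate)) →
                               T (pairwise (apart₇ c) (Certificate.coords innerCertificate)) → BallsCollisionFree n k
ballsCollisionFree-sevenfold (suc m′) c refl refl (s≤s 5≤m′) outer-apart inner-apart =
    Sevenfold.collisionFree m′ c 5≤m′ (Certificate.coords outerCertificate) outer-apart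
  , Sevenfold.collisionFree m′ c 5≤m′ (Certificate.coords innerCertificate) inner-apart

coprime-sevenfold : ∀ i {n k} .{{_ : NonZero i}} → Coprime i 7 → i * n ≡ 7 * k → ∃ λ m → n ≡ 7 * m × k ≡ i * m
coprime-sevenfold i {n} {k} coprime i*n≡7k with coprime-divisor coprime (divides n (trans (sym i*n≡7k) (*-comm i n)))
... | divides m k≡m*i = m , *-cancelˡ-≡ n (7 * m) i i*n≡i*7m , trans k≡m*i (*-comm m i)
  where
  rearrange : ∀ a b c → a * (b * c) ≡ c * (a * b)
  rearrange = solve-∀
  i*n≡i*7m : i * n ≡ i * (7 * m)
  i*n≡i*7m = trans i*n≡7k (trans (cong (7 *_) k≡m*i) (rearrange 7 m i))

ballsCollisionFree-large : ∀ {n k} .{{_ : NonZero n}} i .{{_ : NonZero i}} → Coprime i 7 → i * n ≡ 7 * k → 42 ≤ n →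
                           T (pairwise (apart₇ i) (Certificate.coords outerCertificate)) →
                           T (pairwise (apart₇ i) (Certificate.coords innerCertificate)) → BallsCollisionFree n k
ballsCollisionFree-large i coprime i*n≡7k 42≤n =
  let m , n≡7m , k≡im = coprime-sevenfold i coprime i*n≡7k
  in  ballsCollisionFree-sevenfold m i n≡7m k≡im (*-cancelˡ-≤ 7 (subst (42 ≤_) n≡7m 42≤n))

ballsCollisionFree : ∀ {n k} .{{_ : NonZero n}} → (∃ λ i → (i ≡ 1 ⊎ i ≡ 2 ⊎ i ≡ 3) × i * n ≡ 7 * k) →
                     (42 ≤ n ⊎ (n ≡ 28 × k ≡ 8) ⊎ (n ≡ 35 × k ≡ 10) ⊎ (n ≡ 35 × k ≡ 15)) → BallsCollisionFree n k
ballsCollisionFree (.1 , inj₁ refl , i*n≡7k) (inj₁ 42≤n) =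
  ballsCollisionFree-large 1 (toWitness {a? = coprime? 1 7} _) i*n≡7k 42≤n _ _
ballsCollisionFree (.2 , inj₂ (inj₁ refl) , i*n≡7k) (inj₁ 42≤n) =
  ballsCollisionFree-large 2 (toWitness {a? = coprime? 2 7} _) i*n≡7k 42≤n _ _
ballsCollisionFree (.3 , inj₂ (inj₂ refl) , i*n≡7k) (inj₁ 42≤n) =
  ballsCollisionFree-large 3 (toWitness {a? = coprime? 3 7} _) i*n≡7k 42≤n _ _
ballsCollisionFree _ (inj₂ (inj₁ (refl , refl)))        = ballsCollisionFree-mod 28 8 _ _
ballsCollisionFree _ (inj₂ (inj₂ (inj₁ (refl , refl)))) = ballsCollisionFree-mod 35 10 _ _
ballsCollisionFree _ (inj₂ (inj₂ (inj₂ (refl , refl)))) = ballsCollisionFree-mod 35 15 _ _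

lemma2p3 : (n k : ℕ) → .{{_ : NonZero n}} →
    1 ≤ k → 5 ≤ n → 2 * k < n →
    (∃ λ i → (i ≡ 1 ⊎ i ≡ 2 ⊎ i ≡ 3) × i * n ≡ 7 * k) →
    (42 ≤ n ⊎ (n ≡ 28 × k ≡ 8) ⊎ (n ≡ 35 × k ≡ 10) ⊎ (n ≡ 35 × k ≡ 15)) →
    (r : Vertex n) (cops : Cops n) →
    ¬ Trapped n k cops r →
    ∃ λ r′ → Move n k r r′ ×
      ((cops′ : Cops n) → (∀ c → Move n k (cops c) (cops′ c)) →
        ¬ Trapped n k cops′ r′)
lemma2p3 n k _ 5≤n _ (i , i∈ , i*n≡7k) sizes =
  GeneralisedPetersen.escape n k (≤-trans (n≤1+n 4) 5≤n) (divides i (sym i*n≡7k))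
    (ballsCollisionFree (i , i∈ , i*n≡7k) sizes)
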